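{- Let $t_0\in\mathbb{N}$ and let $\hat{\mathbb{G}}_{t_0}$ be the random $\Sigma^{t_0+1}$-messaged graph defined below. Let $\hat{\mathbb{G}}_{\mathrm{WP}}$ be the messaged graph obtained by keeping the underlying graph of $\hat{\mathbb{G}}_{t_0}$ and its time-$0$ messages, discarding all other entries of the histories, and running Warning Propagation with update rule $\varphi$ for $t_0$ steps from this initialisation. Let $X_0$ be the set of vertices at which some half-edges were deleted in the final (matching) step of the construction of $\hat{\mathbb{G}}_{t_0}$, and for $t\in\mathbb{N}$ let $X_t$ be the set of vertices at distance at most $t$ from $X_0$ in $\hat{\mathbb{G}}_{t_0}$. Then deterministically the histories in $\hat{\mathbb{G}}_{\mathrm{WP}}$ and $\hat{\mathbb{G}}_{t_0}$ agree on all edges not incident to $X_{t_0}$; moreover, on edges incident to $X_{t_0}$ but not to $X_{t_0-1}$, the histories in $\hat{\mathbb{G}}_{\mathrm{WP}}$ and $\hat{\mathbb{G}}_{t_0}$ are identical up to time $t_0-1$.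
   Context: $\mathcal{Z}_1,\dots,\mathcal{Z}_k$ are probability distributions on $\mathbb{N}_0^k$, $\mathcal{Z}_{ij}$ the $j$-th marginal; $(i,j)$ admissible if $\Pr(\mathcal{Z}_{ij}\ge1)>0$, and then $\hat{\mathcal{Z}}_i^{(j)}$ has $\Pr(\hat{\mathcal{Z}}_i^{(j)}=a)=\Pr(\mathcal{Z}_i=a+e_j)/\Pr(\mathcal{Z}_{ij}\ge1)$. Generating items "with types according to $\mathcal{D}$" means sampling $(a_1,\dots,a_k)\sim\mathcal{D}$ and creating $a_h$ items of type $h$. $\mathcal{T}_{ij}$: root edge $(u,v)$, $u$ of type $i$, $v$ of type $j$ the parent of $u$ with no other children; recursively each vertex of type $h$ with parent of type $\ell$ gets children according to $\hat{\mathcal{Z}}_h^{(\ell)}$. $\Sigma$ is a finite alphabet, $\sigma\in\Sigma$ encoding source/target types $g(\sigma)\in[k]^2$; $\varphi$ maps finite multisets over $\Sigma$ to $\Sigma$; Warning Propagation updates in parallel $\mu_{x\to y}(t+1)=\varphi(\{\!\{\mu_{z\to x}(t):zx\in E,z\ne y\}\!\})$. $Q_0$ is a $k\times k$ matrix of probability distributions on $\Sigma$ ($Q_0[i,j]$: message from type $i$ to type $j$), and $Q_0^{(\le t)}[i,j]$ is the law of the history $(\mu_{u\to v}(0),\dots,\mu_{u\to v}(t))$ in a random $\mathcal{T}_{ij}$ with all messages initialised independently according to $Q_0$ and WP run. $\hat{\mathbb{G}}_{t_0}$: (1) sample class sizes $(n_1,\dots,n_k)$ from a given distribution and create vertex classes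 $V_i$; (2) for each $v\in V_i$ independently, generate half-edges of types $(i,j)$ according to $\mathcal{Z}_i$; each half-edge of type $(i,j)$ independently gets an in-story in $\Sigma^{t_0+1}$ from $Q_0^{(\le t_0)}[j,i]$ and a time-$0$ out-message from $Q_0[i,j]$; (3) for $1\le t\le t_0$ the time-$t$ out-message on a half-edge at $v$ is $\varphi$ of the multiset of time-$(t-1)$ in-story entries on the other half-edges at $v$; the out-story is the vector of out-messages at times $0..t_0$; (4) among matchings of half-edges that are maximum subject to matching a half-edge with (in-story, out-story) $(\vec\mu_1,\vec\mu_2)$ only with one having $(\vec\mu_2,\vec\mu_1)$ and the resulting graph being simple, choose one uniformly; delete unmatched half-edges; each directed edge $(u,v)$ carries as history the out-story at $u$ (= in-story at $v$). -}

module Defs where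

open import Data.Nat using (ℕ; zero; suc; _+_; _≤_; _∸_)
open import Data.Fin using (Fin; zero; suc; inject₁; _≟_)
open import Data.Vec using (Vec; lookup; tabulate)
open import Data.List using (List; []; _∷_; map; filter; allFin; mapMaybe)
open import Data.Nat.ListAction using (sum)
open import Data.List.Relation.Binary.Permutation.Propositional using (_↭_)
open import Data.Maybe using (Maybe; just; nothing; is-just)
import Data.Maybe as Maybe
open import Data.Bool using (if_then_else_)
open import Data.Product using (_×_; ∃; ∃₂; _,_)
open import Data.Sum using (_⊎_)
open import Relation.Binary.PropositionalEquality using (_≡_; _≢_)
open import Relation.Nullary using (¬_)
open import Relation.Nullary.Decidable using (_×-dec_; ¬?)

IsMultisetFunction : {Σ : Set} → (List Σ → Σ) → Set
IsMultisetFunction {Σ} φ = ∀ (xs ys : List Σ) → xs ↭ ys → φ xs ≡ φ ys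

-- An outcome of steps (1)-(2) of the construction of Ĝ_{t0}:
-- n vertices, m half-edges, each half-edge h sits at vertex owner h,
-- carries an in-story in Σ^{t0+1} and a time-0 out-message.
record HalfEdgeConfig (Σ : Set) (t0 : ℕ) : Set where
  field
    n       : ℕ
    m       : ℕ
    owner   : Fin m → Fin n
    inStory : Fin m → Vec Σ (suc t0)
    out0    : Fin m → Σ

module _ {Σ : Set} {t0 : ℕ} (C : HalfEdgeConfig Σ t0) where
  open HalfEdgeConfig C

  others : Fin m → List (Fin m)
  others h = filter (λ h′ → (owner h′ ≟ owner h) ×-dec ¬? (h′ ≟ h)) (allFin m)

  outMsg : (List Σ → Σ) → Fin m → Fin (suc t0) → Σ
  outMsg φ h zero    = out0 h
  outMsg φ h (suc t) = φ (map (λ h′ → lookup (inStory h′) (inject₁ t)) (others h))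

  outStory : (List Σ → Σ) → Fin m → Vec Σ (suc t0)
  outStory φ h = tabulate (outMsg φ h)

  -- A (partial) matching of half-edges: M h = just h′ means h is matched to h′,
  -- M h = nothing means h is unmatched (deleted in step (4)).
  Matching : Set
  Matching = Fin m → Maybe (Fin m)

  record ValidMatching (φ : List Σ → Σ) (M : Matching) : Set where
    field
      symmetric  : ∀ h h′ → M h ≡ just h′ → M h′ ≡ just h
      compatible : ∀ h h′ → M h ≡ just h′ →
                   (inStory h ≡ outStory φ h′) × (outStory φ h ≡ inStory h′)
      noLoop     : ∀ h h′ → M h ≡ just h′ → owner h ≢ owner h′
      noMulti    : ∀ h₁ h₁′ h₂ h₂′ → M h₁ ≡ just h₁′ → M h₂ ≡ just h₂′ →
                   owner h₁ ≡ owner h₂ → owner h₁′ ≡ owner h₂′ → h₁ ≡ h₂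

  matchedCount : Matching → ℕ
  matchedCount M = sum (map (λ h → if is-just (M h) then 1 else 0) (allFin m))

  MaximumValidMatching : (List Σ → Σ) → Matching → Set
  MaximumValidMatching φ M =
    ValidMatching φ M × (∀ M′ → ValidMatching φ M′ → matchedCount M′ ≤ matchedCount M)

  module _ (M : Matching) where
    -- The directed edge (u,v)
    -- is identified with the matched half-edge h at u whose partner is at v.
    wp : (List Σ → Σ) → ℕ → Fin m → Σ
    wp φ zero    h = out0 h
    wp φ (suc t) h = φ (mapMaybe (λ h′ → Maybe.map (wp φ t) (M h′)) (others h))

    wpHistory : (List Σ → Σ) → Fin m → Vec Σ (suc t0)
    wpHistory φ h = tabulate (λ t → wp φ (Data.Fin.toℕ t) h)

    -- X_t: vertices at distance ≤ t from X_0 (vertices with a deleted half-edge)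
    InX : ℕ → Fin n → Set
    InX zero    v = ∃ λ h → owner h ≡ v × M h ≡ nothing
    InX (suc t) v = InX t v ⊎ ∃₂ λ h h′ → owner h ≡ v × M h ≡ just h′ × InX t (owner h′)

{-# OPTIONS --safe #-}
module Submission where

-- The two histories on a half-edge h are computed by the same recursion and
-- differ only in their inputs: the stored in-stories of Ĝ_{t0} versus the
-- messages Warning Propagation itself produces.  By matching compatibility the
-- in-story of a matched half-edge is the out-story of its partner, so an
-- induction on t shows that the time-t messages agree at every vertex outside
-- X_t: such a vertex has lost no half-edge, and each neighbour lies outside
-- X_{t-1}.  Since X_t ⊆ X_{t0} for t ≤ t0, this gives both claims.

open import Defs
open import Data.Nat using (ℕ; zero; suc; _≤_; _∸_; z≤n; _≤′_; ≤′-refl; ≤′-step)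
open import Data.Nat.Properties using (≤⇒≤′; suc-injective)
open import Data.Fin using (Fin; toℕ; inject₁; zero; suc)
open import Data.Fin.Properties using (toℕ-inject₁; toℕ≤pred[n])
open import Data.Vec using (lookup)
open import Data.Vec.Properties using (lookup∘tabulate; tabulate-cong)
open import Data.List using (List; []; _∷_; map; mapMaybe; allFin)
open import Data.List.Relation.Unary.All using (All; []; _∷_)
import Data.List.Relation.Unary.All as All
open import Data.List.Relation.Unary.All.Properties using (all-filter)
open import Data.Maybe using (Maybe; just; nothing)
import Data.Maybe as Maybe
open import Data.Empty using (⊥-elim)
open import Data.Product using (_×_; _,_; proj₁)
open import Data.Sum using (_⊎_; inj₁; inj₂)
open import Relation.Binary.PropositionalEquality
open import Relation.Nullary using (¬_)
open import Function using (_∘_)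

All-just⇒mapMaybe≡map : {A B : Set} (F : A → Maybe B) (f : A → B) (xs : List A) →
  All (λ x → F x ≡ just (f x)) xs → mapMaybe F xs ≡ map f xs
All-just⇒mapMaybe≡map F f []       []         = refl
All-just⇒mapMaybe≡map F f (x ∷ xs) (Fx ∷ Fxs) rewrite Fx =
  cong (f x ∷_) (All-just⇒mapMaybe≡map F f xs Fxs)

module _ {Σ : Set} {t0 : ℕ} (C : HalfEdgeConfig Σ t0) (M : Matching C) where
  open HalfEdgeConfig C

  InX-mono : ∀ {s t v} → s ≤ t → InX C M s v → InX C M t v
  InX-mono s≤t = InX-mono′ (≤⇒≤′ s≤t)
    where
    InX-mono′ : ∀ {s t v} → s ≤′ t → InX C M s v → InX C M t v
    InX-mono′ ≤′-refl        x = x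
    InX-mono′ (≤′-step s≤′t) x = inj₁ (InX-mono′ s≤′t x)

  others-sameOwner : ∀ h → All (λ h′ → owner h′ ≡ owner h) (others C h)
  others-sameOwner h = All.map proj₁ (all-filter _ (allFin m))

  module _ (φ : List Σ → Σ) (V : ValidMatching C φ M) where

    inStory≡partner-outMsg : ∀ {h g} → M h ≡ just g →
      ∀ i → lookup (inStory h) i ≡ outMsg C φ g i
    inStory≡partner-outMsg {h} {g} Mh≡g i = begin
      lookup (inStory h) i       ≡⟨ cong (λ v → lookup v i) (ValidMatching.compatible V h g Mh≡g .proj₁) ⟩
      lookup (outStory C φ g) i  ≡⟨ lookup∘tabulate (outMsg C φ g) i ⟩
      outMsg C φ g i             ∎
      where open ≡-Reasoning

    -- The index i : Fin (suc t0) is tied to the time t by an equation, so that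
    -- the recursion is structural on t rather than on i (which would recurse
    -- on inject₁ j).
    wp≡outMsg-outsideX : ∀ t (i : Fin (suc t0)) → toℕ i ≡ t →
      ∀ h → ¬ InX C M t (owner h) → wp C M φ t h ≡ outMsg C φ h i
    wp≡outMsg-outsideX zero    zero    _   h _   = refl
    wp≡outMsg-outsideX (suc t) (suc j) j≡t h h∉X =
      cong φ (All-just⇒mapMaybe≡map _ _ (others C h) (All.map neighbourMsg (others-sameOwner h)))
      where
      neighbourMsg : ∀ {h′} → owner h′ ≡ owner h →
        Maybe.map (wp C M φ t) (M h′) ≡ just (lookup (inStory h′) (inject₁ j))
      neighbourMsg {h′} sameOwner with M h′ in Mh′
      ... | nothing = ⊥-elim (h∉X (InX-mono z≤n (h′ , sameOwner , Mh′)))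
      ... | just g  = cong just (begin
        wp C M φ t g                     ≡⟨ wp≡outMsg-outsideX t (inject₁ j) inject₁j≡t g g∉X ⟩
        outMsg C φ g (inject₁ j)         ≡⟨ inStory≡partner-outMsg Mh′ (inject₁ j) ⟨
        lookup (inStory h′) (inject₁ j)  ∎)
        where
        open ≡-Reasoning
        inject₁j≡t : toℕ (inject₁ j) ≡ t
        inject₁j≡t = trans (toℕ-inject₁ j) (suc-injective j≡t)
        g∉X : ¬ InX C M t (owner g)
        g∉X g∈X = h∉X (inj₂ (h′ , g , sameOwner , Mh′ , g∈X))

    wpHistory≡outStory-at : ∀ h (i : Fin (suc t0)) → ¬ InX C M (toℕ i) (owner h) →
      lookup (wpHistory C M φ h) i ≡ lookup (outStory C φ h) i
    wpHistory≡outStory-at h i h∉X = begin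
      lookup (wpHistory C M φ h) i  ≡⟨ lookup∘tabulate (λ k → wp C M φ (toℕ k) h) i ⟩
      wp C M φ (toℕ i) h            ≡⟨ wp≡outMsg-outsideX (toℕ i) i refl h h∉X ⟩
      outMsg C φ h i                ≡⟨ lookup∘tabulate (outMsg C φ h) i ⟨
      lookup (outStory C φ h) i     ∎
      where open ≡-Reasoning

proposition5p10 : {Σ : Set} (φ : List Σ → Σ) → IsMultisetFunction φ →
    (t0 : ℕ) (C : HalfEdgeConfig Σ t0) (M : Matching C) →
    MaximumValidMatching C φ M →
    (∀ h h′ → M h ≡ just h′ →
      ¬ InX C M t0 (HalfEdgeConfig.owner C h) → ¬ InX C M t0 (HalfEdgeConfig.owner C h′) →
      wpHistory C M φ h ≡ outStory C φ h)
    × (∀ h h′ → M h ≡ just h′ →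
      (InX C M t0 (HalfEdgeConfig.owner C h) ⊎ InX C M t0 (HalfEdgeConfig.owner C h′)) →
      ¬ InX C M (t0 ∸ 1) (HalfEdgeConfig.owner C h) → ¬ InX C M (t0 ∸ 1) (HalfEdgeConfig.owner C h′) →
      ∀ (t : Fin _) → toℕ t ≤ t0 ∸ 1 →
      lookup (wpHistory C M φ h) t ≡ lookup (outStory C φ h) t)
proposition5p10 φ _ t0 C M (valid , _) =
    (λ h _ _ h∉X _ → tabulate-cong λ i →
      wp≡outMsg-outsideX C M φ valid (toℕ i) i refl h (h∉X ∘ InX-mono C M (toℕ≤pred[n] i)))
  , (λ h _ _ _ h∉X _ t t≤t0∸1 →
      wpHistory≡outStory-at C M φ valid h t (h∉X ∘ InX-mono C M t≤t0∸1))
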